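{- Let $\lambda X$ be a supersorted pure type system with specification $(\mathcal S,\mathcal A,\mathcal R)$ and let $\lambda X^h$, with specification $(\mathcal S,\mathcal A,\mathcal B)$, be its corresponding Hilbert-style pure type system. Then: (i) if $(M:A)\in\mathcal A\cup\mathcal B$, then there is $s\in\mathcal S$ such that $(A:s)\in\mathcal A\cup\mathcal B$; (ii) if $([\lambda x_1{:}A_1\ldots\lambda x_{i-1}{:}A_{i-1}.\Pi x_i{:}A_i.B]:[\Pi x_1{:}A_1\ldots\Pi x_{i-1}{:}A_{i-1}.s])\in\mathcal B$, then there is $s'\in\mathcal S$ such that $([\lambda x_1{:}A_1\ldots\lambda x_i{:}A_i.B]:[\Pi x_1{:}A_1\ldots\Pi x_i{:}A_i.s'])\in\mathcal B$.
   Context: Pure type systems (PTS). A PTS $\lambda X$ has variables, constants $\mathcal C$, sorts $\mathcal S\subseteq\mathcal C$, axioms $\mathcal A$ ($c:s$), rules $\mathcal R\subseteq\mathcal S^3$; pseudoterms $\mathcal T::=V\mid\mathcal C\mid\Pi V{:}\mathcal T.\mathcal T\mid\lambda V{:}\mathcal T.\mathcal T\mid\mathcal T\mathcal T$; derivable judgements $\Gamma\vdash M:A$ generated by (axiom) $\vdash c:s$ for $(c:s)\in\mathcal A$; (start) $\Gamma\vdash A:s\Rightarrow\Gamma,x:A\vdash x:A$ ($x$ fresh); (weakening) $\Gamma\vdash M:B$, $\Gamma\vdash A:s\Rightarrow\Gamma,x:A\vdash M:B$ ($x$ fresh); (application) $\Gamma\vdash M:\Pi x{:}A.B$, $\Gamma\vdash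 N:A\Rightarrow\Gamma\vdash MN:B[x:=N]$; (abstraction) $\Gamma,x:A\vdash M:B$, $\Gamma\vdash(\Pi x{:}A.B):s\Rightarrow\Gamma\vdash(\lambda x{:}A.M):(\Pi x{:}A.B)$; (product) $\Gamma,x:A\vdash B:s_2$, $\Gamma\vdash A:s_1$, $(s_1,s_2,s_3)\in\mathcal R\Rightarrow\Gamma\vdash(\Pi x{:}A.B):s_3$; (conversion) $\Gamma\vdash M:A$, $\Gamma\vdash B:s$, $A=_\beta B\Rightarrow\Gamma\vdash M:B$. Supersorted: every $c\in\mathcal C$ has some $s$ with $(c:s)\in\mathcal A$, and for all $s_1,s_2\in\mathcal S$ there is $s_3$ with $(s_1,s_2,s_3)\in\mathcal R$. Corresponding HPTS $\lambda X^h$: specification $(\mathcal S,\mathcal A,\mathcal B)$ where $\mathcal B$ consists of the following schemes, each standing for all its instances (sorts substituted for sort variables) that are derivable judgements of $\lambda X$: (Π1) $\vdash[\lambda u{:}s_1.\lambda v{:}(\Pi x{:}u.s_2).\Pi x{:}u.vx]:[\Pi u{:}s_1.\Pi v{:}(\Pi x{:}u.s_2).s_3]$ for $(s_1,s_2,s_3)\in\mathcal R$; (I1) $\vdash[\lambda x{:}s_1.\lambda y{:}x.y]:[\Pi x{:}s_1.\Pi y{:}x.x]$; (K1) $\vdash[\lambda x{:}s_1.\lambda y{:}s_2.\lambda z{:}x.\lambda u{:}y.z]:[\Pi x{:}s_1.\Pi y{:}s_2.\Pi z{:}x.\Pi u{:}y.x]$; (S1) $\vdash[\lambda u{:}s_1.\lambda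 v{:}(\Pi x{:}u.s_2).\lambda t{:}(\Pi x{:}u.\Pi y{:}vx.s_3).\lambda w{:}(\Pi x{:}u.\Pi y{:}vx.txy).\lambda z{:}(\Pi x{:}u.vx).\lambda x{:}u.wx(zx)]:[\Pi u{:}s_1.\Pi v{:}(\Pi x{:}u.s_2).\Pi t{:}(\Pi x{:}u.\Pi y{:}vx.s_3).\Pi w{:}(\Pi x{:}u.\Pi y{:}vx.txy).\Pi z{:}(\Pi x{:}u.vx).\Pi x{:}u.tx(zx)]$; plus those generated by the closure rules: (I) if $(M:A)\in\mathcal B$, $A\notin\mathcal S$, and $A'$ arises from $A$ by replacing zero or more repeated occurrences of a sort variable $s_i$ by a sort variable $s_j$ not in $A$, then $(A':s)\in\mathcal B$ for each $s\in\mathcal S$ with $\vdash A':s$ derivable in $\lambda X$; (II) if $([\lambda x_1{:}A_1\ldots\lambda x_{i-1}{:}A_{i-1}.\Pi x_i{:}A_i.B]:[\Pi x_1{:}A_1\ldots\Pi x_{i-1}{:}A_{i-1}.s])\in\mathcal B$ and $s'\in\mathcal S$ is such that $\vdash(\lambda x_1{:}A_1\ldots\lambda x_i{:}A_i.B):(\Pi x_1{:}A_1\ldots\Pi x_i{:}A_i.s')$ is derivable in $\lambda X$, then this judgement is in $\mathcal B$. -}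

module Defs where

open import Data.Nat using (ℕ; zero; suc)
open import Data.Empty using (⊥)
open import Data.List using (List; []; _∷_; _∷ʳ_)
open import Data.Product using (Σ; _×_; ∃; ∃-syntax; _,_)
open import Data.Sum using (_⊎_)
open import Relation.Nullary using (¬_)
open import Relation.Binary.PropositionalEquality using (_≡_)
open import Relation.Binary.Construct.Closure.Equivalence using (EqClosure)

-- Tm C X : pseudoterms over constants C, with "sort variables" named by X.
--   * concrete pseudoterms of λX are  Tm C ⊥  (no sort variables);
--   * schemes (as in the axiom schemes of an HPTS) are  Tm C ℕ.
-- pi A B / lam A B bind de Bruijn variable 0 in B.

data Tm (C : Set) (X : Set) : Set where
  var : ℕ → Tm C X
  cst : C → Tm C X
  sv  : X → Tm C X
  pi  : Tm C X → Tm C X → Tm C X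
  lam : Tm C X → Tm C X → Tm C X
  app : Tm C X → Tm C X → Tm C X

module _ {C X : Set} where

  ext : (ℕ → ℕ) → ℕ → ℕ
  ext ρ zero    = zero
  ext ρ (suc n) = suc (ρ n)

  ren : (ℕ → ℕ) → Tm C X → Tm C X
  ren ρ (var n)   = var (ρ n)
  ren ρ (cst c)   = cst c
  ren ρ (sv x)    = sv x
  ren ρ (pi A B)  = pi (ren ρ A) (ren (ext ρ) B)
  ren ρ (lam A B) = lam (ren ρ A) (ren (ext ρ) B)
  ren ρ (app M N) = app (ren ρ M) (ren ρ N)

  shift : Tm C X → Tm C X
  shift = ren suc

  exts : (ℕ → Tm C X) → ℕ → Tm C X
  exts σ zero    = var zero
  exts σ (suc n) = shift (σ n)

  sub : (ℕ → Tm C X) → Tm C X → Tm C X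
  sub σ (var n)   = σ n
  sub σ (cst c)   = cst c
  sub σ (sv x)    = sv x
  sub σ (pi A B)  = pi (sub σ A) (sub (exts σ) B)
  sub σ (lam A B) = lam (sub σ A) (sub (exts σ) B)
  sub σ (app M N) = app (sub σ M) (sub σ N)

  single : Tm C X → ℕ → Tm C X
  single N zero    = N
  single N (suc n) = var n

  _[_] : Tm C X → Tm C X → Tm C X
  B [ N ] = sub (single N) B

  data _→β_ : Tm C X → Tm C X → Set where
    beta : ∀ {A M N} → app (lam A M) N →β (M [ N ])
    piL  : ∀ {A A' B} → A →β A' → pi A B →β pi A' B
    piR  : ∀ {A B B'} → B →β B' → pi A B →β pi A B'
    lamL : ∀ {A A' B} → A →β A' → lam A B →β lam A' B
    lamR : ∀ {A B B'} → B →β B' → lam A B →β lam A B'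
    appL : ∀ {M M' N} → M →β M' → app M N →β app M' N
    appR : ∀ {M N N'} → N →β N' → app M N →β app M N'

  _=β_ : Tm C X → Tm C X → Set
  _=β_ = EqClosure _→β_

  lams : List (Tm C X) → Tm C X → Tm C X
  lams []       B = B
  lams (A ∷ As) B = lam A (lams As B)

  pis : List (Tm C X) → Tm C X → Tm C X
  pis []       B = B
  pis (A ∷ As) B = pi A (pis As B)

record PTS : Set₁ where
  field
    C        : Set
    IsSort   : C → Set
    Ax       : C → C → Set
    Rl       : C → C → C → Set
    ax-sort  : ∀ {c s} → Ax c s → IsSort s
    rl-sort  : ∀ {s₁ s₂ s₃} → Rl s₁ s₂ s₃ → IsSort s₁ × IsSort s₂ × IsSort s₃

module PTSDefs (P : PTS) where
  open PTS P public

  Term : Set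
  Term = Tm C ⊥

  Scheme : Set
  Scheme = Tm C ℕ

  -- contexts: the head is the most recently added declaration (variable 0)
  Ctx : Set
  Ctx = List Term

  data _⊢_∶_ : Ctx → Term → Term → Set where
    axiom : ∀ {c s} → Ax c s → [] ⊢ cst c ∶ cst s
    start : ∀ {Γ A s} → IsSort s → Γ ⊢ A ∶ cst s → (A ∷ Γ) ⊢ var 0 ∶ shift A
    weak  : ∀ {Γ M B A s} → IsSort s → Γ ⊢ M ∶ B → Γ ⊢ A ∶ cst s →
            (A ∷ Γ) ⊢ shift M ∶ shift B
    appl  : ∀ {Γ M N A B} → Γ ⊢ M ∶ pi A B → Γ ⊢ N ∶ A → Γ ⊢ app M N ∶ (B [ N ])
    abst  : ∀ {Γ A M B s} → IsSort s → (A ∷ Γ) ⊢ M ∶ B → Γ ⊢ pi A B ∶ cst s →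
            Γ ⊢ lam A M ∶ pi A B
    prod  : ∀ {Γ A B s₁ s₂ s₃} → (A ∷ Γ) ⊢ B ∶ cst s₂ → Γ ⊢ A ∶ cst s₁ →
            Rl s₁ s₂ s₃ → Γ ⊢ pi A B ∶ cst s₃
    conv  : ∀ {Γ M A B s} → IsSort s → Γ ⊢ M ∶ A → Γ ⊢ B ∶ cst s → A =β B →
            Γ ⊢ M ∶ B

  Supersorted : Set
  Supersorted = (∀ c → ∃[ s ] Ax c s)
              × (∀ s₁ s₂ → IsSort s₁ → IsSort s₂ → ∃[ s₃ ] Rl s₁ s₂ s₃)

  record Assign : Set where
    field
      fn     : ℕ → C
      sorts  : ∀ n → IsSort (fn n)
  open Assign public

  inst : Assign → Scheme → Term
  inst σ (var n)   = var n
  inst σ (cst c)   = cst c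
  inst σ (sv x)    = cst (fn σ x)
  inst σ (pi A B)  = pi (inst σ A) (inst σ B)
  inst σ (lam A B) = lam (inst σ A) (inst σ B)
  inst σ (app M N) = app (inst σ M) (inst σ N)

  data IsSortScheme : Scheme → Set where
    svS  : ∀ n → IsSortScheme (sv n)
    cstS : ∀ {c} → IsSort c → IsSortScheme (cst c)

  data Occurs (j : ℕ) : Scheme → Set where
    here : Occurs j (sv j)
    piL  : ∀ {A B} → Occurs j A → Occurs j (pi A B)
    piR  : ∀ {A B} → Occurs j B → Occurs j (pi A B)
    lamL : ∀ {A B} → Occurs j A → Occurs j (lam A B)
    lamR : ∀ {A B} → Occurs j B → Occurs j (lam A B)
    appL : ∀ {M N} → Occurs j M → Occurs j (app M N)
    appR : ∀ {M N} → Occurs j N → Occurs j (app M N)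

  data Repl (i j : ℕ) : Scheme → Scheme → Set where
    rvar  : ∀ n → Repl i j (var n) (var n)
    rcst  : ∀ c → Repl i j (cst c) (cst c)
    rsv   : ∀ n → Repl i j (sv n) (sv n)
    rswap : Repl i j (sv i) (sv j)
    rpi   : ∀ {A A' B B'} → Repl i j A A' → Repl i j B B' → Repl i j (pi A B) (pi A' B')
    rlam  : ∀ {A A' B B'} → Repl i j A A' → Repl i j B B' → Repl i j (lam A B) (lam A' B')
    rapp  : ∀ {M M' N N'} → Repl i j M M' → Repl i j N N' → Repl i j (app M N) (app M' N')

  -- the axiom schemes (sort variables s₁,s₂,s₃ are sv 0, sv 1, sv 2)
  Π1-tm Π1-ty I1-tm I1-ty K1-tm K1-ty S1-tm S1-ty : Scheme
  -- λu:s₁.λv:(Πx:u.s₂).Πx:u.vx  :  Πu:s₁.Πv:(Πx:u.s₂).s₃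
  Π1-tm = lam (sv 0) (lam (pi (var 0) (sv 1)) (pi (var 1) (app (var 1) (var 0))))
  Π1-ty = pi (sv 0) (pi (pi (var 0) (sv 1)) (sv 2))
  -- λx:s₁.λy:x.y  :  Πx:s₁.Πy:x.x
  I1-tm = lam (sv 0) (lam (var 0) (var 0))
  I1-ty = pi (sv 0) (pi (var 0) (var 1))
  -- λx:s₁.λy:s₂.λz:x.λu:y.z  :  Πx:s₁.Πy:s₂.Πz:x.Πu:y.x
  K1-tm = lam (sv 0) (lam (sv 1) (lam (var 1) (lam (var 1) (var 1))))
  K1-ty = pi (sv 0) (pi (sv 1) (pi (var 1) (pi (var 1) (var 3))))
  S1-tm = lam (sv 0)
         (lam (pi (var 0) (sv 1))
         (lam (pi (var 1) (pi (app (var 1) (var 0)) (sv 2)))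
         (lam (pi (var 2) (pi (app (var 2) (var 0)) (app (app (var 2) (var 1)) (var 0))))
         (lam (pi (var 3) (app (var 3) (var 0)))
         (lam (var 4)
              (app (app (var 2) (var 0)) (app (var 1) (var 0))))))))
  S1-ty = pi (sv 0)
         (pi (pi (var 0) (sv 1))
         (pi (pi (var 1) (pi (app (var 1) (var 0)) (sv 2)))
         (pi (pi (var 2) (pi (app (var 2) (var 0)) (app (app (var 2) (var 1)) (var 0))))
         (pi (pi (var 3) (app (var 3) (var 0)))
         (pi (var 4)
              (app (app (var 3) (var 0)) (app (var 1) (var 0))))))))

  -- 𝔅ˢ m a σ : the scheme (m : a) is generated in ℬ, and its instance under
  -- the sort assignment σ is a derivable judgement of λX (hence an element of ℬ).
  data 𝔅ˢ : Scheme → Scheme → Assign → Set where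
    Π1 : ∀ σ → Rl (fn σ 0) (fn σ 1) (fn σ 2) →
         [] ⊢ inst σ Π1-tm ∶ inst σ Π1-ty → 𝔅ˢ Π1-tm Π1-ty σ
    I1 : ∀ σ → [] ⊢ inst σ I1-tm ∶ inst σ I1-ty → 𝔅ˢ I1-tm I1-ty σ
    K1 : ∀ σ → [] ⊢ inst σ K1-tm ∶ inst σ K1-ty → 𝔅ˢ K1-tm K1-ty σ
    S1 : ∀ σ → [] ⊢ inst σ S1-tm ∶ inst σ S1-ty → 𝔅ˢ S1-tm S1-ty σ
    clI : ∀ {m a a' σ i j s} → 𝔅ˢ m a σ → ¬ IsSortScheme a →
          Repl i j a a' → ¬ Occurs j a →
          IsSort s → (τ : Assign) → [] ⊢ inst τ a' ∶ cst s →
          𝔅ˢ a' (cst s) τ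
    clII : ∀ {As Ai B s σ s'} →
           𝔅ˢ (lams As (pi Ai B)) (pis As s) σ → IsSortScheme s →
           IsSort s' →
           [] ⊢ inst σ (lams (As ∷ʳ Ai) B) ∶ inst σ (pis (As ∷ʳ Ai) (cst s')) →
           (τ : Assign) →
           [] ⊢ inst τ (lams (As ∷ʳ Ai) B) ∶ inst τ (pis (As ∷ʳ Ai) (cst s')) →
           𝔅ˢ (lams (As ∷ʳ Ai) B) (pis (As ∷ʳ Ai) (cst s')) τ

  _∶_∈ℬ : Term → Term → Set
  M ∶ A ∈ℬ = ∃[ m ] ∃[ a ] ∃[ σ ] (𝔅ˢ m a σ × inst σ m ≡ M × inst σ a ≡ A)

  _∶_∈𝒜 : Term → Term → Set
  M ∶ A ∈𝒜 = ∃[ c ] ∃[ s ] (Ax c s × M ≡ cst c × A ≡ cst s)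

  _∶_∈𝒜∪ℬ : Term → Term → Set
  M ∶ A ∈𝒜∪ℬ = M ∶ A ∈𝒜 ⊎ M ∶ A ∈ℬ

-- Every type in ℬ is a sort or a Π-type whose inhabitant is an abstraction. A sort has a type
-- in 𝒜 by supersortedness; a Π-type of an abstraction is typed by a sort (generation for λ),
-- and closure rule (I) with zero replacements puts that typing into ℬ.
-- For (ii), in a supersorted PTS typability of λx⃗.Πx:A.B yields λx⃗.λx:A.B : Πx⃗.Πx:A.s': the
-- product rule supplies B : s₂, and a rule (s₁, s₂', s₃) with s₂ : s₂' makes Πx:A.s₂ a type.
-- Every scheme of ℬ whose instance has that shape is a λ-prefix over a Π with a sort-ending
-- type, so closure rule (II) applies to it.
module Submission where

open import Defs
open import Data.List using (List; []; _∷_; _∷ʳ_)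
open import Data.Product using (_×_; ∃-syntax; _,_; proj₁; proj₂)
open import Data.Sum using (inj₁; inj₂)
open import Data.Empty using (⊥; ⊥-elim)
open import Data.Unit using (⊤; tt)
open import Data.Nat using (ℕ; suc; _<_; _⊔_)
open import Data.Nat.Properties using (<-irrefl; n<1+n; m≤m⊔n; m≤n⊔m; <-≤-trans)
open import Relation.Nullary using (¬_)
open import Relation.Binary.PropositionalEquality using (_≡_; refl; sym; cong₂; subst; subst₂)

lam-injective : ∀ {C X} {A A' B B' : Tm C X} → lam A B ≡ lam A' B' → A ≡ A' × B ≡ B'
lam-injective refl = refl , refl

pi-injective : ∀ {C X} {A A' B B' : Tm C X} → pi A B ≡ pi A' B' → A ≡ A' × B ≡ B'
pi-injective refl = refl , refl

EndsInPi : ∀ {C X} → Tm C X → Set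
EndsInPi (lam A B) = EndsInPi B
EndsInPi (pi A B)  = ⊤
EndsInPi _         = ⊥

lams-pi-endsInPi : ∀ {C X} (L : List (Tm C X)) {A B : Tm C X} → EndsInPi (lams L (pi A B))
lams-pi-endsInPi []      = tt
lams-pi-endsInPi (_ ∷ L) = lams-pi-endsInPi L

module Typing (P : PTS) where
  open PTSDefs P

  data IsLam : Term → Set where
    isLam : ∀ {A B} → IsLam (lam A B)

  lams-snoc-isLam : ∀ L A B → IsLam (lams (L ∷ʳ A) B)
  lams-snoc-isLam []      A B = isLam
  lams-snoc-isLam (_ ∷ L) A B = isLam

  ren-reflects-isLam : ∀ ρ (M : Term) → IsLam (ren ρ M) → IsLam M
  ren-reflects-isLam ρ (lam A B) _ = isLam
  ren-reflects-isLam ρ (var n)   ()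
  ren-reflects-isLam ρ (cst c)   ()
  ren-reflects-isLam ρ (sv ())   _
  ren-reflects-isLam ρ (pi A B)  ()
  ren-reflects-isLam ρ (app M N) ()

  ⊢-subst : ∀ {Γ M M' T T'} → M ≡ M' → T ≡ T' → Γ ⊢ M ∶ T → Γ ⊢ M' ∶ T'
  ⊢-subst = subst₂ (λ M T → _ ⊢ M ∶ T)

  abstraction-type-sorted : ∀ {Γ M T} → Γ ⊢ M ∶ T → IsLam M → ∃[ s ] (IsSort s × Γ ⊢ T ∶ cst s)
  abstraction-type-sorted (weak {M = M} sS d dA) lamM
    with s , s-sort , dT ← abstraction-type-sorted d (ren-reflects-isLam suc M lamM)
    = s , s-sort , weak sS dT dA
  abstraction-type-sorted (abst sS _ dT)   isLam = _ , sS , dT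
  abstraction-type-sorted (conv sS _ dT _) _     = _ , sS , dT

  context-head-sorted : ∀ {Γ A M T} → (A ∷ Γ) ⊢ M ∶ T → ∃[ s ] (IsSort s × Γ ⊢ A ∶ cst s)
  context-head-sorted (start sS dA)  = _ , sS , dA
  context-head-sorted (weak sS _ dA) = _ , sS , dA
  context-head-sorted (appl d _)     = context-head-sorted d
  context-head-sorted (abst _ _ d)   = context-head-sorted d
  context-head-sorted (prod _ d _)   = context-head-sorted d
  context-head-sorted (conv _ d _ _) = context-head-sorted d

  axiom-in-context : ∀ {Γ M T c s} → Γ ⊢ M ∶ T → Ax c s → Γ ⊢ cst c ∶ cst s
  axiom-in-context (axiom _)      ax = axiom ax
  axiom-in-context (start sS d)   ax = weak sS (axiom-in-context d ax) d
  axiom-in-context (weak sS d dA) ax = weak sS (axiom-in-context d ax) dA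
  axiom-in-context (appl d _)     ax = axiom-in-context d ax
  axiom-in-context (abst _ _ d)   ax = axiom-in-context d ax
  axiom-in-context (prod _ d _)   ax = axiom-in-context d ax
  axiom-in-context (conv _ d _ _) ax = axiom-in-context d ax

  ren-lams-pi-inv : ∀ ρ (M : Term) (L : List Term) {A B : Term} → ren ρ M ≡ lams L (pi A B) →
    ∃[ L₀ ] ∃[ A₀ ] ∃[ B₀ ] (M ≡ lams L₀ (pi A₀ B₀)
      × ren ρ (lams (L₀ ∷ʳ A₀) B₀) ≡ lams (L ∷ʳ A) B
      × (∀ c → ren ρ (pis (L₀ ∷ʳ A₀) (cst c)) ≡ pis (L ∷ʳ A) (cst c)))
  ren-lams-pi-inv ρ (pi A₀ B₀) [] refl = [] , A₀ , B₀ , refl , refl , λ _ → refl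
  ren-lams-pi-inv ρ (lam X Y)  (_ ∷ L) e
    with eX , eY ← lam-injective e
    with L₀ , A₀ , B₀ , refl , eLam , ePi ← ren-lams-pi-inv (ext {C} {⊥} ρ) Y L eY
    = X ∷ L₀ , A₀ , B₀ , refl , cong₂ lam eX eLam , λ c → cong₂ pi eX (ePi c)
  ren-lams-pi-inv ρ (var n)   []      ()
  ren-lams-pi-inv ρ (var n)   (_ ∷ _) ()
  ren-lams-pi-inv ρ (cst c)   []      ()
  ren-lams-pi-inv ρ (cst c)   (_ ∷ _) ()
  ren-lams-pi-inv ρ (sv ())   _       _
  ren-lams-pi-inv ρ (pi A B)  (_ ∷ _) ()
  ren-lams-pi-inv ρ (lam A B) []      ()
  ren-lams-pi-inv ρ (app M N) []      ()
  ren-lams-pi-inv ρ (app M N) (_ ∷ _) ()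

  module _ (supersorted : Supersorted) where

    ⊢-pi-to-lam : ∀ {Γ M T} → Γ ⊢ M ∶ T → ∀ L {A B} → M ≡ lams L (pi A B) →
      ∃[ s' ] (IsSort s' × Γ ⊢ lams (L ∷ʳ A) B ∶ pis (L ∷ʳ A) (cst s'))
    ⊢-pi-to-lam (weak {M = M₀} sS d dA) L e
      with L₀ , A₀ , B₀ , e₀ , eLam , ePi ← ren-lams-pi-inv suc M₀ L e
      with s' , s'-sort , d' ← ⊢-pi-to-lam d L₀ e₀
      = s' , s'-sort , ⊢-subst eLam (ePi s') (weak sS d' dA)
    ⊢-pi-to-lam (abst sS d _) (_ ∷ L) refl
      with s' , s'-sort , d' ← ⊢-pi-to-lam d L refl
      with s₂ , s₂-sort , dT ← abstraction-type-sorted d' (lams-snoc-isLam L _ _)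
      with s₁ , s₁-sort , dA ← context-head-sorted dT
      with s₃ , r ← proj₂ supersorted s₁ s₂ s₁-sort s₂-sort
      = s' , s'-sort , abst (proj₂ (proj₂ (rl-sort r))) d' (prod dT dA r)
    ⊢-pi-to-lam (prod {s₂ = s₂} dB dA r) [] refl
      with s₂' , ax ← proj₁ supersorted s₂
      with s₃ , r' ← proj₂ supersorted _ s₂' (proj₁ (rl-sort r)) (ax-sort ax)
      = s₂ , proj₁ (proj₂ (rl-sort r))
           , abst (proj₂ (proj₂ (rl-sort r'))) dB (prod (axiom-in-context dB ax) dA r')
    ⊢-pi-to-lam (conv _ d _ _) L e = ⊢-pi-to-lam d L e
    ⊢-pi-to-lam (axiom _)    []      ()
    ⊢-pi-to-lam (axiom _)    (_ ∷ _) ()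
    ⊢-pi-to-lam (start _ _)  []      ()
    ⊢-pi-to-lam (start _ _)  (_ ∷ _) ()
    ⊢-pi-to-lam (appl _ _)   []      ()
    ⊢-pi-to-lam (appl _ _)   (_ ∷ _) ()
    ⊢-pi-to-lam (abst _ _ _) []      ()
    ⊢-pi-to-lam (prod _ _ _) (_ ∷ _) ()

module Schemes (P : PTS) where
  open PTSDefs P
  open Typing P

  𝔅ˢ-sound : ∀ {m a σ} → 𝔅ˢ m a σ → [] ⊢ inst σ m ∶ inst σ a
  𝔅ˢ-sound (Π1 _ _ d)          = d
  𝔅ˢ-sound (I1 _ d)            = d
  𝔅ˢ-sound (K1 _ d)            = d
  𝔅ˢ-sound (S1 _ d)            = d
  𝔅ˢ-sound (clI _ _ _ _ _ _ d) = d
  𝔅ˢ-sound (clII _ _ _ _ _ d)  = d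

  -- The sort-ending type forces the λ-prefix of the scheme to be as long as that of its instance.
  inst-lams-pi-inv : ∀ σ L X Y As {Ai B s} → IsSortScheme Y →
    inst σ (lams L X) ≡ lams As (pi Ai B) → inst σ (pis L Y) ≡ pis As (cst s) →
    ∃[ Ai₀ ] ∃[ B₀ ] (X ≡ pi Ai₀ B₀
      × inst σ (lams (L ∷ʳ Ai₀) B₀) ≡ lams (As ∷ʳ Ai) B
      × (∀ c → inst σ (pis (L ∷ʳ Ai₀) (cst c)) ≡ pis (As ∷ʳ Ai) (cst c)))
  inst-lams-pi-inv σ [] (pi Ai₀ B₀) Y [] _ refl _ = Ai₀ , B₀ , refl , refl , λ _ → refl
  inst-lams-pi-inv σ (_ ∷ L) X Y (_ ∷ As) sortY eLam ePi
    with eA , eLam' ← lam-injective eLam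
    with _ , ePi' ← pi-injective ePi
    with Ai₀ , B₀ , eX , eLam″ , ePi″ ← inst-lams-pi-inv σ L X Y As sortY eLam' ePi'
    = Ai₀ , B₀ , eX , cong₂ lam eA eLam″ , λ c → cong₂ pi eA (ePi″ c)
  inst-lams-pi-inv σ [] (var _)   _ []      _        ()
  inst-lams-pi-inv σ [] (cst _)   _ []      _        ()
  inst-lams-pi-inv σ [] (sv _)    _ []      _        ()
  inst-lams-pi-inv σ [] (lam _ _) _ []      _        ()
  inst-lams-pi-inv σ [] (app _ _) _ []      _        ()
  inst-lams-pi-inv σ [] _         _ (_ ∷ _) (svS _)  _ ()
  inst-lams-pi-inv σ [] _         _ (_ ∷ _) (cstS _) _ ()
  inst-lams-pi-inv σ (_ ∷ _) _    _ []      _        _ ()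

  module _ (supersorted : Supersorted) where

    ℬ-scheme-pi-to-lam : ∀ {σ} L X Y → 𝔅ˢ (lams L X) (pis L Y) σ → IsSortScheme Y →
      ∀ As {Ai B s} → inst σ (lams L X) ≡ lams As (pi Ai B) → inst σ (pis L Y) ≡ pis As (cst s) →
      ∃[ s' ] (IsSort s' × lams (As ∷ʳ Ai) B ∶ pis (As ∷ʳ Ai) (cst s') ∈ℬ)
    ℬ-scheme-pi-to-lam {σ} L X Y D sortY As eLam ePi
      with Ai₀ , B₀ , refl , eLam' , ePi' ← inst-lams-pi-inv σ L X Y As sortY eLam ePi
      with s' , s'-sort , d ← ⊢-pi-to-lam supersorted (⊢-subst eLam ePi (𝔅ˢ-sound D)) As refl
      = s' , s'-sort
      , (_ , _ , σ , clII D sortY s'-sort d' σ d' , eLam' , ePi' s')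
      where
      d' : [] ⊢ inst σ (lams (L ∷ʳ Ai₀) B₀) ∶ inst σ (pis (L ∷ʳ Ai₀) (cst s'))
      d' = ⊢-subst (sym eLam') (sym (ePi' s')) d

    ℬ-pi-to-lam : ∀ As Ai B s → IsSort s → lams As (pi Ai B) ∶ pis As (cst s) ∈ℬ →
      ∃[ s' ] (IsSort s' × lams (As ∷ʳ Ai) B ∶ pis (As ∷ʳ Ai) (cst s') ∈ℬ)
    ℬ-pi-to-lam As Ai B s _ (_ , _ , _ , D , eLam , ePi) = go D eLam ePi
      where
      target-endsInPi : ∀ {M} → M ≡ lams As (pi Ai B) → EndsInPi M
      target-endsInPi e = subst EndsInPi (sym e) (lams-pi-endsInPi As)

      go : ∀ {m a σ} → 𝔅ˢ m a σ → inst σ m ≡ lams As (pi Ai B) → inst σ a ≡ pis As (cst s) →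
        ∃[ s' ] (IsSort s' × lams (As ∷ʳ Ai) B ∶ pis (As ∷ʳ Ai) (cst s') ∈ℬ)
      go D@(Π1 _ _ _) = ℬ-scheme-pi-to-lam (sv 0 ∷ pi (var 0) (sv 1) ∷ []) _ (sv 2) D (svS 2) As
      go (I1 _ _) e _ = ⊥-elim (target-endsInPi e)
      go (K1 _ _) e _ = ⊥-elim (target-endsInPi e)
      go (S1 _ _) e _ = ⊥-elim (target-endsInPi e)
      go D@(clI _ _ _ _ s-sort _ _) = ℬ-scheme-pi-to-lam [] _ _ D (cstS s-sort) As
      go D@(clII {As = As₀} {Ai = Ai₀} _ _ s-sort _ _ _) =
        ℬ-scheme-pi-to-lam (As₀ ∷ʳ Ai₀) _ _ D (cstS s-sort) As

sortVarBound : ∀ {C} → Tm C ℕ → ℕ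
sortVarBound (sv n)    = suc n
sortVarBound (pi A B)  = sortVarBound A ⊔ sortVarBound B
sortVarBound (lam A B) = sortVarBound A ⊔ sortVarBound B
sortVarBound (app A B) = sortVarBound A ⊔ sortVarBound B
sortVarBound _         = 0

module SortVariables (P : PTS) where
  open PTSDefs P

  occurs-<-sortVarBound : ∀ {j a} → Occurs j a → j < sortVarBound a
  occurs-<-sortVarBound here     = n<1+n _
  occurs-<-sortVarBound (piL o)  = <-≤-trans (occurs-<-sortVarBound o) (m≤m⊔n _ _)
  occurs-<-sortVarBound (piR o)  = <-≤-trans (occurs-<-sortVarBound o) (m≤n⊔m _ _)
  occurs-<-sortVarBound (lamL o) = <-≤-trans (occurs-<-sortVarBound o) (m≤m⊔n _ _)
  occurs-<-sortVarBound (lamR o) = <-≤-trans (occurs-<-sortVarBound o) (m≤n⊔m _ _)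
  occurs-<-sortVarBound (appL o) = <-≤-trans (occurs-<-sortVarBound o) (m≤m⊔n _ _)
  occurs-<-sortVarBound (appR o) = <-≤-trans (occurs-<-sortVarBound o) (m≤n⊔m _ _)

  sortVarBound-fresh : ∀ a → ¬ Occurs (sortVarBound a) a
  sortVarBound-fresh a o = <-irrefl refl (occurs-<-sortVarBound o)

  repl-refl : ∀ {i j} a → Repl i j a a
  repl-refl (var n)   = rvar n
  repl-refl (cst c)   = rcst c
  repl-refl (sv n)    = rsv n
  repl-refl (pi A B)  = rpi (repl-refl A) (repl-refl B)
  repl-refl (lam A B) = rlam (repl-refl A) (repl-refl B)
  repl-refl (app A B) = rapp (repl-refl A) (repl-refl B)

module TypesSorted (P : PTS) (supersorted : PTSDefs.Supersorted P) where
  open PTSDefs P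
  open Typing P
  open Schemes P
  open SortVariables P

  sort-typed-in-𝒜 : ∀ s₀ → ∃[ s ] (IsSort s × cst s₀ ∶ cst s ∈𝒜∪ℬ)
  sort-typed-in-𝒜 s₀ with s , ax ← proj₁ supersorted s₀ =
    s , ax-sort ax , inj₁ (s₀ , s , ax , refl , refl)

  -- Closure rule (I) with zero replacements; any sort variable not occurring in the type will do.
  pi-type-typed-in-ℬ : ∀ {m X Y σ} → 𝔅ˢ m (pi X Y) σ → IsLam (inst σ m) →
    ∃[ s ] (IsSort s × inst σ (pi X Y) ∶ cst s ∈𝒜∪ℬ)
  pi-type-typed-in-ℬ {X = X} {Y} {σ} D lamM
    with s , s-sort , d ← abstraction-type-sorted (𝔅ˢ-sound D) lamM
    = s , s-sort , inj₂ (pi X Y , cst s , σ , rule-I , refl , refl)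
    where
    rule-I : 𝔅ˢ (pi X Y) (cst s) σ
    rule-I = clI {i = 0} D (λ ()) (repl-refl _) (sortVarBound-fresh (pi X Y)) s-sort σ d

  ℬ-type-typed : ∀ {m a σ} → 𝔅ˢ m a σ → ∃[ s ] (IsSort s × inst σ a ∶ cst s ∈𝒜∪ℬ)
  ℬ-type-typed D@(Π1 _ _ _)                      = pi-type-typed-in-ℬ D isLam
  ℬ-type-typed D@(I1 _ _)                        = pi-type-typed-in-ℬ D isLam
  ℬ-type-typed D@(K1 _ _)                        = pi-type-typed-in-ℬ D isLam
  ℬ-type-typed D@(S1 _ _)                        = pi-type-typed-in-ℬ D isLam
  ℬ-type-typed (clI {s = s} _ _ _ _ _ _ _)       = sort-typed-in-𝒜 s
  ℬ-type-typed D@(clII {As = []} _ _ _ _ _ _)    = pi-type-typed-in-ℬ D isLam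
  ℬ-type-typed D@(clII {As = _ ∷ _} _ _ _ _ _ _) = pi-type-typed-in-ℬ D isLam

  𝒜∪ℬ-type-typed : ∀ M A → M ∶ A ∈𝒜∪ℬ → ∃[ s ] (IsSort s × A ∶ cst s ∈𝒜∪ℬ)
  𝒜∪ℬ-type-typed M A (inj₁ (_ , s , _ , _ , refl))     = sort-typed-in-𝒜 s
  𝒜∪ℬ-type-typed M A (inj₂ (_ , _ , _ , D , _ , refl)) = ℬ-type-typed D

lemma18 : (P : PTS) → PTSDefs.Supersorted P →
    let open PTSDefs P in
    (∀ (M A : Term) → M ∶ A ∈𝒜∪ℬ → ∃[ s ] (IsSort s × A ∶ cst s ∈𝒜∪ℬ))
    ×
    (∀ (As : List Term) (Ai B : Term) (s : C) → IsSort s →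
    lams As (pi Ai B) ∶ pis As (cst s) ∈ℬ →
    ∃[ s' ] (IsSort s' × lams (As ∷ʳ Ai) B ∶ pis (As ∷ʳ Ai) (cst s') ∈ℬ))
lemma18 P supersorted =
  TypesSorted.𝒜∪ℬ-type-typed P supersorted , Schemes.ℬ-pi-to-lam P supersorted
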